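{- Let $\Delta$ be a $(d-1)$-dimensional boolean complex with nonnegative, symmetric $h$-vector $h=(h_0,\dots,h_d)$ and $\gamma$-vector $\gamma=(\gamma_0,\dots,\gamma_{\lfloor d/2\rfloor})$. If $\gamma$ is the $f$-vector of a balanced simplicial complex, then $h$ is the $f$-vector of a balanced simplicial complex.
   Context: A boolean complex is a regular cell complex whose lower intervals $[\emptyset,F]$ in the face poset are boolean lattices. $f(\Delta;t)=\sum_Ft^{1+\dim F}$ (empty face included), $\sum_ih_it^i=(1-t)^df(\Delta;t/(1-t))$; symmetric means $h_i=h_{d-i}$, and then $\gamma$ is defined by $\sum_ih_it^i=\sum_{i=0}^{\lfloor d/2\rfloor}\gamma_it^i(1+t)^{d-2i}$. The $f$-vector of a simplicial complex is $(f_0,f_1,\dots)$ with $f_i$ the number of faces with $i$ vertices, $f_0=1$. An $(m-1)$-dimensional simplicial complex is balanced if its vertices can be colored with $m$ colors so that every face has distinctly colored vertices. -}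

module Defs where

open import Data.Nat using (ℕ; zero; suc; _∸_; _≤_; _<_; _≡ᵇ_; _≤ᵇ_; _*_; ⌊_/2⌋)
open import Data.Nat.Combinatorics using (_C_)
open import Data.Integer as ℤ using (ℤ; +_; -_)
open import Data.Bool using (Bool; true; false; if_then_else_; _∧_; T)
open import Data.Fin using (Fin)
open import Data.Fin.Subset using (Subset; _⊆_; _∈_; ∣_∣; outside; inside) renaming (⊥ to ∅)
open import Data.List using (List; []; _∷_; _++_; map; foldr)
open import Data.List using () renaming (allFin to allFinL)
open import Data.Vec using (Vec; []; _∷_)
open import Data.Product using (Σ; _×_; ∃; ∃-syntax)
open import Relation.Binary.PropositionalEquality using (_≡_)

count : {A : Set} → (A → Bool) → List A → ℕ
count p = foldr (λ x n → if p x then suc n else n) 0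

sumTo : ℕ → (ℕ → ℤ) → ℤ
sumTo zero    f = f 0
sumTo (suc n) f = sumTo n f ℤ.+ f (suc n)

signPow : ℕ → ℤ
signPow zero    = + 1
signPow (suc j) = - signPow j

allSubsets : (n : ℕ) → List (Subset n)
allSubsets zero    = [] ∷ []
allSubsets (suc n) = map (outside ∷_) (allSubsets n) ++ map (inside ∷_) (allSubsets n)

-- Boolean complexes, given combinatorially by their face poset
-- (a finite poset with least element, every lower interval [∅,F]
-- order-isomorphic to a boolean lattice; rank F = 1 + dim F).

record BooleanComplex : Set₁ where
  field
    N      : ℕ                         -- number of faces (empty face included)
    _≤F_   : Fin N → Fin N → Bool
    refl≤  : ∀ F → T (F ≤F F)
    antisym≤ : ∀ F G → T (F ≤F G) → T (G ≤F F) → F ≡ G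
    trans≤ : ∀ F G H → T (F ≤F G) → T (G ≤F H) → T (F ≤F H)
    empty  : Fin N
    empty≤ : ∀ F → T (empty ≤F F)
    rank   : Fin N → ℕ
    -- order isomorphism  [empty , F]  ≅  (Subset (rank F), ⊆)
    φ      : (F : Fin N) → Fin N → Subset (rank F)
    ψ      : (F : Fin N) → Subset (rank F) → Fin N
    ψ≤     : ∀ F s → T (ψ F s ≤F F)
    φψ     : ∀ F s → φ F (ψ F s) ≡ s
    ψφ     : ∀ F G → T (G ≤F F) → ψ F (φ F G) ≡ G
    φ-mono : ∀ F G G′ → T (G ≤F F) → T (G′ ≤F F) → T (G ≤F G′) → φ F G ⊆ φ F G′
    φ-refl : ∀ F G G′ → T (G ≤F F) → T (G′ ≤F F) → φ F G ⊆ φ F G′ → T (G ≤F G′)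

open BooleanComplex public

HasDim-1 : BooleanComplex → ℕ → Set
HasDim-1 Δ d = (∀ F → rank Δ F ≤ d) × (∃[ F ] rank Δ F ≡ d)

-- f_i(Δ) = number of faces F with 1 + dim F = i  (f_0 = 1, the empty face)
fBC : BooleanComplex → ℕ → ℕ
fBC Δ i = count (λ F → rank Δ F ≡ᵇ i) (allFinL (N Δ))

-- h-vector:  Σ_k h_k t^k = (1-t)^d f(Δ; t/(1-t)) = Σ_i f_i t^i (1-t)^(d-i),
-- so h_k = Σ_{i=0}^k (-1)^(k-i) C(d-i, k-i) f_i
hBC : BooleanComplex → ℕ → ℕ → ℤ
hBC Δ d k = sumTo k (λ i → signPow (k ∸ i) ℤ.* ((+ ((d ∸ i) C (k ∸ i))) ℤ.* (+ fBC Δ i)))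

-- coefficient of t^k in  t^i (1+t)^a
coeffShift : ℕ → ℕ → ℕ → ℕ
coeffShift a i k = if i ≤ᵇ k then a C (k ∸ i) else 0

-- γ is the γ-vector of h (length d):  h(t) = Σ_{i=0}^{⌊d/2⌋} γ_i t^i (1+t)^(d-2i)
IsGammaVector : ℕ → (ℕ → ℤ) → (ℕ → ℤ) → Set
IsGammaVector d h γ =
  ∀ k → k ≤ d → h k ≡ sumTo ⌊ d /2⌋ (λ i → γ i ℤ.* (+ coeffShift (d ∸ (2 * i)) i k))

record SimplicialComplex (n : ℕ) : Set where
  field
    face      : Subset n → Bool
    emptyFace : T (face ∅)
    downClosed : ∀ σ τ → τ ⊆ σ → T (face σ) → T (face τ)

open SimplicialComplex public

fSC : {n : ℕ} → SimplicialComplex n → ℕ → ℕ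
fSC {n} Γ i = count (λ σ → face Γ σ ∧ (∣ σ ∣ ≡ᵇ i)) (allSubsets n)

SCHasDim-1 : {n : ℕ} → SimplicialComplex n → ℕ → Set
SCHasDim-1 {n} Γ m = (∀ σ → T (face Γ σ) → ∣ σ ∣ ≤ m) × (∃[ σ ] (T (face Γ σ) × ∣ σ ∣ ≡ m))

IsBalanced : {n : ℕ} → SimplicialComplex n → Set
IsBalanced {n} Γ = Σ ℕ λ m → SCHasDim-1 Γ m ×
  Σ (Fin n → Fin m) λ κ → ((σ : Subset n) → T (face Γ σ) →
     ∀ (u v : Fin n) → u ∈ σ → v ∈ σ → κ u ≡ κ v → u ≡ v)

IsBalancedFVector : ℕ → (ℕ → ℤ) → Set
IsBalancedFVector L v = Σ ℕ λ n → Σ (SimplicialComplex n) λ Γ → IsBalanced Γ ×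
  ((∀ i → i ≤ L → + fSC Γ i ≡ v i) × (∀ i → L < i → fSC Γ i ≡ 0))

-- Since h(t) = Σⱼ γⱼ tʲ (1+t)^(d-2j), it suffices to turn a balanced Γ with colours in [L],
-- L = ⌊d/2⌋, into a balanced complex with f-polynomial h.  Add d new vertices: two copies of
-- every colour and d - 2L free ones, and let s ∪ t (s old, t new) be a face iff s ∈ Γ and t
-- avoids both copies of every colour occurring in s.  Over a j-face s of Γ, t then ranges over
-- all subsets of a (d-2j)-set, contributing tʲ (1+t)^(d-2j).  Colouring every new vertex by
-- itself and an old vertex by the first copy of its colour is proper, since on a face the old
-- vertices have distinct colours and t avoids the copies of those colours.

module Submission where

open import Defs
open import Data.Bool using (Bool; true; false; if_then_else_; _∧_; T)
open import Data.Bool.Properties using (∧-assoc; ∧-zeroʳ; T-∧; T-≡)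
open import Data.Empty using (⊥-elim)
open import Data.Fin using (Fin; zero; suc; _↑ˡ_; _↑ʳ_; splitAt; join; inject≤)
open import Data.Fin.Properties as Finₚ
  using (↑ˡ-injective; join-splitAt; inject≤-injective)
open import Data.Fin.Subset
  using (Subset; inside; outside; _∈_; _∉_; _⊆_; ∣_∣; ⁅_⁆; _∪_; ∁) renaming (⊥ to ∅)
open import Data.Fin.Subset.Properties
  using (_⊆?_; ∉⊥; ⊥⊆; ⊆-refl; ⊆-trans; ∣⊥∣≡0; ∣p∣≤n; p⊆q⇒∣p∣≤∣q∣; ∣∁p∣≡n∸∣p∣; p⊆q⇒∁p⊇∁q;
         x∈p⇒x∉∁p; x∈⁅x⁆; x∈⁅y⁆⇒x≡y; x∈p∪q⁺; x∈p∪q⁻; ∪-identityˡ)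
open import Data.Integer as ℤ using (ℤ; +_) renaming (_≤_ to _≤ℤ_)
open import Data.Integer.Properties using (pos-+; pos-*)
open import Data.List as List using (List; []; _∷_; map)
open import Data.List.Properties using (map-++; map-∘; map-cong)
open import Data.Nat using (ℕ; zero; suc; _+_; _*_; _∸_; _≤_; _<_; _≡ᵇ_; _≤ᵇ_; ⌊_/2⌋; z≤n; s≤s; s≤s⁻¹)
open import Data.Nat.Combinatorics using (_C_; nCk+nC[k+1]≡[n+1]C[k+1])
open import Data.Nat.ListAction using (sum)
open import Data.Nat.ListAction.Properties using (sum-++)
open import Data.Nat.Properties
open import Algebra.Properties.CommutativeSemigroup +-commutativeSemigroup using (interchange)
open import Data.Product using (_×_; _,_; ∃-syntax)
open import Data.Sum using (_⊎_; inj₁; inj₂; [_,_]′)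
open import Data.Vec using (Vec; []; _∷_; take; drop; here; there) renaming (_++_ to _⧺_)
open import Data.Vec.Properties using (take++drop≡id; ++-injectiveˡ; ++-injectiveʳ)
open import Function using (_∘_; id; Equivalence)
open import Relation.Binary.PropositionalEquality
open import Relation.Nullary using (does; contradiction)
open import Relation.Nullary.Decidable using (toWitness; fromWitness; isYes≗does)

private
  variable
    A : Set
    m n : ℕ

count-++ : (p : A → Bool) (xs ys : List A) → count p (xs List.++ ys) ≡ count p xs + count p ys
count-++ p []       ys = refl
count-++ p (x ∷ xs) ys with p x
... | true  = cong suc (count-++ p xs ys)
... | false = count-++ p xs ys

count-map : {B : Set} (p : B → Bool) (f : A → B) (xs : List A) → count p (map f xs) ≡ count (p ∘ f) xs
count-map p f []       = refl
count-map p f (x ∷ xs) with p (f x)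
... | true  = cong suc (count-map p f xs)
... | false = count-map p f xs

count-cong : {p q : A → Bool} → (∀ x → p x ≡ q x) → (xs : List A) → count p xs ≡ count q xs
count-cong p≗q []       = refl
count-cong p≗q (x ∷ xs) = cong₂ (λ b c → if b then suc c else c) (p≗q x) (count-cong p≗q xs)

count-false : {p : A → Bool} → (∀ x → p x ≡ false) → (xs : List A) → count p xs ≡ 0
count-false {p = p} p≡false xs = trans (count-cong p≡false xs) (count-const xs)
  where
  count-const : (xs : List A) → count (λ _ → false) xs ≡ 0
  count-const []       = refl
  count-const (_ ∷ xs) = count-const xs

count-allSubsets-suc : (p : Subset (suc n) → Bool) →
  count p (allSubsets (suc n)) ≡
  count (p ∘ (outside ∷_)) (allSubsets n) + count (p ∘ (inside ∷_)) (allSubsets n)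
count-allSubsets-suc {n} p = trans (count-++ p (map (outside ∷_) (allSubsets n)) _)
  (cong₂ _+_ (count-map p (outside ∷_) (allSubsets n)) (count-map p (inside ∷_) (allSubsets n)))

0<count-allSubsets : (p : Subset n → Bool) (σ : Subset n) → T (p σ) → 0 < count p (allSubsets n)
0<count-allSubsets p [] pσ with p []
... | true  = s≤s z≤n
... | false = ⊥-elim pσ
0<count-allSubsets p (outside ∷ σ) pσ = subst (0 <_) (sym (count-allSubsets-suc p))
  (<-≤-trans (0<count-allSubsets (p ∘ (outside ∷_)) σ pσ) (m≤m+n _ _))
0<count-allSubsets p (inside ∷ σ) pσ = subst (0 <_) (sym (count-allSubsets-suc p))
  (<-≤-trans (0<count-allSubsets (p ∘ (inside ∷_)) σ pσ) (m≤n+m _ _))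

count-allSubsets-++ : ∀ m {n} (p : Subset (m + n) → Bool) →
  count p (allSubsets (m + n)) ≡ sum (map (λ s → count (λ t → p (s ⧺ t)) (allSubsets n)) (allSubsets m))
count-allSubsets-++ zero    p = sym (+-identityʳ _)
count-allSubsets-++ (suc m) {n} p = begin
  count p (allSubsets (suc m + n))
    ≡⟨ count-allSubsets-suc p ⟩
  count (p ∘ (outside ∷_)) (allSubsets (m + n)) + count (p ∘ (inside ∷_)) (allSubsets (m + n))
    ≡⟨ cong₂ _+_ (count-allSubsets-++ m (p ∘ (outside ∷_))) (count-allSubsets-++ m (p ∘ (inside ∷_))) ⟩
  sum (map (F ∘ (outside ∷_)) S) + sum (map (F ∘ (inside ∷_)) S)
    ≡⟨ cong₂ _+_ (cong sum (map-∘ S)) (cong sum (map-∘ S)) ⟩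
  sum (map F (map (outside ∷_) S)) + sum (map F (map (inside ∷_) S))
    ≡⟨ sym (sum-++ (map F (map (outside ∷_) S)) _) ⟩
  sum (map F (map (outside ∷_) S) List.++ map F (map (inside ∷_) S))
    ≡⟨ cong sum (sym (map-++ F (map (outside ∷_) S) _)) ⟩
  sum (map F (allSubsets (suc m))) ∎
  where
  open ≡-Reasoning
  S = allSubsets m
  F = λ s → count (λ t → p (s ⧺ t)) (allSubsets n)

sumUpTo : ℕ → (ℕ → ℕ) → ℕ
sumUpTo zero    f = f 0
sumUpTo (suc L) f = sumUpTo L f + f (suc L)

sumUpTo-cong : ∀ L {f g : ℕ → ℕ} → (∀ j → j ≤ L → f j ≡ g j) → sumUpTo L f ≡ sumUpTo L g
sumUpTo-cong zero    f≗g = f≗g 0 z≤n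
sumUpTo-cong (suc L) f≗g = cong₂ _+_ (sumUpTo-cong L (λ j j≤L → f≗g j (m≤n⇒m≤1+n j≤L))) (f≗g (suc L) ≤-refl)

sumUpTo-zero : ∀ L {f : ℕ → ℕ} → (∀ j → j ≤ L → f j ≡ 0) → sumUpTo L f ≡ 0
sumUpTo-zero zero    f≡0 = f≡0 0 z≤n
sumUpTo-zero (suc L) f≡0 = cong₂ _+_ (sumUpTo-zero L (λ j j≤L → f≡0 j (m≤n⇒m≤1+n j≤L))) (f≡0 (suc L) ≤-refl)

sumUpTo-+ : ∀ L (f g : ℕ → ℕ) → sumUpTo L (λ j → f j + g j) ≡ sumUpTo L f + sumUpTo L g
sumUpTo-+ zero    f g = refl
sumUpTo-+ (suc L) f g =
  trans (cong (_+ (f (suc L) + g (suc L))) (sumUpTo-+ L f g))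
        (interchange (sumUpTo L f) (sumUpTo L g) (f (suc L)) (g (suc L)))

≢⇒≡ᵇ≡false : ∀ {i j} → i ≢ j → (i ≡ᵇ j) ≡ false
≢⇒≡ᵇ≡false {i} {j} i≢j with i ≡ᵇ j in eq
... | false = refl
... | true  = contradiction (≡ᵇ⇒≡ i j (Equivalence.from T-≡ eq)) i≢j

sumUpTo-indicator : ∀ L (g : ℕ → ℕ) {a} → a ≤ L → sumUpTo L (λ j → if a ≡ᵇ j then g j else 0) ≡ g a
sumUpTo-indicator zero    g z≤n = refl
sumUpTo-indicator (suc L) g {a} a≤1+L with m≤n⇒m<n∨m≡n a≤1+L
... | inj₁ a<1+L = trans
  (cong₂ _+_ (sumUpTo-indicator L g (s≤s⁻¹ a<1+L))
              (cong (λ b → if b then g (suc L) else 0) (≢⇒≡ᵇ≡false (<⇒≢ a<1+L))))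
  (+-identityʳ (g a))
... | inj₂ refl = cong₂ _+_
  (sumUpTo-zero L (λ j j≤L → cong (λ b → if b then g j else 0) (≢⇒≡ᵇ≡false (>⇒≢ (s≤s j≤L)))))
  (cong (λ b → if b then g a else 0) (Equivalence.to T-≡ (≡⇒≡ᵇ a a refl)))

sum-by-size : (size : A → ℕ) (p : A → Bool) (g : ℕ → ℕ) (L : ℕ) (xs : List A) →
  (∀ x → T (p x) → size x ≤ L) →
  sum (map (λ x → if p x then g (size x) else 0) xs) ≡
  sumUpTo L (λ j → count (λ x → p x ∧ (size x ≡ᵇ j)) xs * g j)
sum-by-size size p g L []       _        = sym (sumUpTo-zero L (λ _ _ → refl))
sum-by-size size p g L (x ∷ xs) size≤L = begin
  (if p x then g (size x) else 0) + sum (map _ xs)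
    ≡⟨ cong₂ _+_ (head (p x) refl) (sum-by-size size p g L xs size≤L) ⟩
  sumUpTo L (λ j → if p x ∧ (size x ≡ᵇ j) then g j else 0) + sumUpTo L (λ j → count _ xs * g j)
    ≡⟨ sym (sumUpTo-+ L _ _) ⟩
  sumUpTo L (λ j → (if p x ∧ (size x ≡ᵇ j) then g j else 0) + count _ xs * g j)
    ≡⟨ sumUpTo-cong L (λ j _ → if-+-* (p x ∧ (size x ≡ᵇ j)) (count _ xs) (g j)) ⟩
  sumUpTo L (λ j → count (λ x → p x ∧ (size x ≡ᵇ j)) (x ∷ xs) * g j) ∎
  where
  open ≡-Reasoning
  if-+-* : ∀ b c y → (if b then y else 0) + c * y ≡ (if b then suc c else c) * y
  if-+-* true  c y = refl
  if-+-* false c y = refl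
  head : ∀ b → p x ≡ b →
    (if b then g (size x) else 0) ≡ sumUpTo L (λ j → if b ∧ (size x ≡ᵇ j) then g j else 0)
  head true  px = sym (sumUpTo-indicator L g (size≤L x (Equivalence.from T-≡ px)))
  head false _  = sym (sumUpTo-zero L (λ _ _ → refl))

+-sumUpTo : ∀ L (f : ℕ → ℕ) → + sumUpTo L f ≡ sumTo L (λ j → + f j)
+-sumUpTo zero    f = refl
+-sumUpTo (suc L) f = trans (pos-+ (sumUpTo L f) _) (cong (ℤ._+ + f (suc L)) (+-sumUpTo L f))

sumTo-cong : ∀ L {f g : ℕ → ℤ} → (∀ j → j ≤ L → f j ≡ g j) → sumTo L f ≡ sumTo L g
sumTo-cong zero    f≗g = f≗g 0 z≤n
sumTo-cong (suc L) f≗g = cong₂ ℤ._+_ (sumTo-cong L (λ j j≤L → f≗g j (m≤n⇒m≤1+n j≤L))) (f≗g (suc L) ≤-refl)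

take-++ : (xs : Vec A m) (ys : Vec A n) → take m (xs ⧺ ys) ≡ xs
take-++ {m = m} xs ys = ++-injectiveˡ _ _ (take++drop≡id m (xs ⧺ ys))

drop-++ : (xs : Vec A m) (ys : Vec A n) → drop m (xs ⧺ ys) ≡ ys
drop-++ {m = m} xs ys = ++-injectiveʳ (take m (xs ⧺ ys)) xs (take++drop≡id m (xs ⧺ ys))

++-elim : ∀ m {n} {P : Vec A (m + n) → Set} → (∀ xs ys → P (xs ⧺ ys)) → ∀ zs → P zs
++-elim m {P = P} P++ zs = subst P (take++drop≡id m zs) (P++ (take m zs) (drop m zs))

↑-elim : ∀ m {n} {P : Fin (m + n) → Set} → (∀ i → P (i ↑ˡ n)) → (∀ j → P (m ↑ʳ j)) → ∀ k → P k
↑-elim m {n} {P} P↑ˡ P↑ʳ k = subst P (join-splitAt m n k) (by-cases (splitAt m k))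
  where
  by-cases : ∀ x → P (join m n x)
  by-cases (inj₁ i) = P↑ˡ i
  by-cases (inj₂ j) = P↑ʳ j

∣++∣ : (p : Subset m) (q : Subset n) → ∣ p ⧺ q ∣ ≡ ∣ p ∣ + ∣ q ∣
∣++∣ []            q = refl
∣++∣ (inside  ∷ p) q = cong suc (∣++∣ p q)
∣++∣ (outside ∷ p) q = ∣++∣ p q

∈-++⁺ˡ : {p : Subset m} {q : Subset n} {i : Fin m} → i ∈ p → i ↑ˡ n ∈ p ⧺ q
∈-++⁺ˡ here        = here
∈-++⁺ˡ (there i∈p) = there (∈-++⁺ˡ i∈p)

∈-++⁺ʳ : (p : Subset m) {q : Subset n} {j : Fin n} → j ∈ q → m ↑ʳ j ∈ p ⧺ q
∈-++⁺ʳ []      j∈q = j∈q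
∈-++⁺ʳ (_ ∷ p) j∈q = there (∈-++⁺ʳ p j∈q)

∈-++⁻ˡ : {p : Subset m} {q : Subset n} (i : Fin m) → i ↑ˡ n ∈ p ⧺ q → i ∈ p
∈-++⁻ˡ {p = _ ∷ _} zero    here        = here
∈-++⁻ˡ {p = _ ∷ _} (suc i) (there i∈p) = there (∈-++⁻ˡ i i∈p)

∈-++⁻ʳ : (p : Subset m) {q : Subset n} {j : Fin n} → m ↑ʳ j ∈ p ⧺ q → j ∈ q
∈-++⁻ʳ []      j∈q         = j∈q
∈-++⁻ʳ (_ ∷ p) (there j∈q) = ∈-++⁻ʳ p j∈q

⊆-++⁺ : {p p′ : Subset m} {q q′ : Subset n} → p ⊆ p′ → q ⊆ q′ → p ⧺ q ⊆ p′ ⧺ q′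
⊆-++⁺ {m} {p = p} {p′} p⊆p′ q⊆q′ {k} = ↑-elim m {P = λ k → k ∈ p ⧺ _ → k ∈ p′ ⧺ _}
  (λ i i∈ → ∈-++⁺ˡ (p⊆p′ (∈-++⁻ˡ i i∈)))
  (λ j j∈ → ∈-++⁺ʳ p′ (q⊆q′ (∈-++⁻ʳ p j∈))) k

⊆-++⁻ : {p p′ : Subset m} {q q′ : Subset n} → p ⧺ q ⊆ p′ ⧺ q′ → p ⊆ p′ × q ⊆ q′
⊆-++⁻ {p = p} {p′} pq⊆ = (λ {i} i∈p → ∈-++⁻ˡ i (pq⊆ (∈-++⁺ˡ i∈p))) , (λ j∈q → ∈-++⁻ʳ p′ (pq⊆ (∈-++⁺ʳ p j∈q)))

⊆?-sound : {t B : Subset n} → T (does (t ⊆? B)) → t ⊆ B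
⊆?-sound {t = t} {B} t⊆B = toWitness (subst T (sym (isYes≗does (t ⊆? B))) t⊆B)

⊆?-complete : {t B : Subset n} → t ⊆ B → T (does (t ⊆? B))
⊆?-complete {t = t} {B} t⊆B = subst T (isYes≗does (t ⊆? B)) (fromWitness (λ {x} → t⊆B {x}))

count-subsets-of-size : (B : Subset n) (k : ℕ) →
  count (λ t → does (t ⊆? B) ∧ (∣ t ∣ ≡ᵇ k)) (allSubsets n) ≡ ∣ B ∣ C k
count-subsets-of-size []            zero    = refl
count-subsets-of-size []            (suc k) = refl
count-subsets-of-size {suc n} (outside ∷ B) k =
  trans (count-allSubsets-suc (λ t → does (t ⊆? outside ∷ B) ∧ (∣ t ∣ ≡ᵇ k)))
  (trans (cong₂ _+_ (count-subsets-of-size B k) (count-false (λ _ → refl) (allSubsets n))) (+-identityʳ _))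
count-subsets-of-size {suc n} (inside ∷ B) zero =
  trans (count-allSubsets-suc (λ t → does (t ⊆? inside ∷ B) ∧ (∣ t ∣ ≡ᵇ 0)))
  (cong₂ _+_ (count-subsets-of-size B 0) (count-false (λ t → ∧-zeroʳ (does (t ⊆? B))) (allSubsets n)))
count-subsets-of-size {suc n} (inside ∷ B) (suc k) =
  trans (count-allSubsets-suc (λ t → does (t ⊆? inside ∷ B) ∧ (∣ t ∣ ≡ᵇ suc k)))
  (trans (cong₂ _+_ (count-subsets-of-size B (suc k)) (count-subsets-of-size B k))
    (trans (+-comm (∣ B ∣ C suc k) (∣ B ∣ C k)) (nCk+nC[k+1]≡[n+1]C[k+1] ∣ B ∣ k)))

count-subsets-of-shifted-size : (B : Subset n) (j i : ℕ) →
  count (λ t → does (t ⊆? B) ∧ (j + ∣ t ∣ ≡ᵇ i)) (allSubsets n) ≡ coeffShift ∣ B ∣ j i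
count-subsets-of-shifted-size B zero    i       = count-subsets-of-size B i
count-subsets-of-shifted-size {n} B (suc j) zero = count-false (λ t → ∧-zeroʳ (does (t ⊆? B))) (allSubsets n)
count-subsets-of-shifted-size B (suc j) (suc i) =
  trans (count-subsets-of-shifted-size B j i)
        (cong (λ b → if b then ∣ B ∣ C (i ∸ j) else 0) (sym (≤ᵇ-suc j i)))
  where
  ≤ᵇ-suc : ∀ j i → (suc j ≤ᵇ suc i) ≡ (j ≤ᵇ i)
  ≤ᵇ-suc zero    i = refl
  ≤ᵇ-suc (suc j) i = refl

image : (Fin m → Fin n) → Subset m → Subset n
image κ []            = ∅
image κ (outside ∷ s) = image (κ ∘ suc) s
image κ (inside  ∷ s) = ⁅ κ zero ⁆ ∪ image (κ ∘ suc) s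

∈-image⁺ : (κ : Fin m → Fin n) {s : Subset m} {v : Fin m} → v ∈ s → κ v ∈ image κ s
∈-image⁺ κ {inside  ∷ s} here        = x∈p∪q⁺ (inj₁ (x∈⁅x⁆ (κ zero)))
∈-image⁺ κ {inside  ∷ s} (there v∈s) = x∈p∪q⁺ (inj₂ (∈-image⁺ (κ ∘ suc) v∈s))
∈-image⁺ κ {outside ∷ s} (there v∈s) = ∈-image⁺ (κ ∘ suc) v∈s

∈-image⁻ : (κ : Fin m → Fin n) (s : Subset m) {c : Fin n} → c ∈ image κ s → ∃[ v ] v ∈ s × κ v ≡ c
∈-image⁻ κ []            c∈ = ⊥-elim (∉⊥ c∈)
∈-image⁻ κ (outside ∷ s) c∈ with ∈-image⁻ (κ ∘ suc) s c∈
... | v , v∈s , κv≡c = suc v , there v∈s , κv≡c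
∈-image⁻ κ (inside  ∷ s) c∈ with x∈p∪q⁻ ⁅ κ zero ⁆ (image (κ ∘ suc) s) c∈
... | inj₁ c∈⁅κ0⁆ = zero , here , sym (x∈⁅y⁆⇒x≡y (κ zero) c∈⁅κ0⁆)
... | inj₂ c∈     with ∈-image⁻ (κ ∘ suc) s c∈
...   | v , v∈s , κv≡c = suc v , there v∈s , κv≡c

image-mono : (κ : Fin m → Fin n) {s s′ : Subset m} → s ⊆ s′ → image κ s ⊆ image κ s′
image-mono κ {s} s⊆s′ c∈ with ∈-image⁻ κ s c∈
... | v , v∈s , refl = ∈-image⁺ κ (s⊆s′ v∈s)

InjectiveOn : (Fin m → Fin n) → Subset m → Set
InjectiveOn κ s = ∀ u v → u ∈ s → v ∈ s → κ u ≡ κ v → u ≡ v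

∣⁅x⁆∪p∣ : {x : Fin n} {p : Subset n} → x ∉ p → ∣ ⁅ x ⁆ ∪ p ∣ ≡ suc ∣ p ∣
∣⁅x⁆∪p∣ {x = zero}  {outside ∷ p} _   = cong suc (cong ∣_∣ (∪-identityˡ p))
∣⁅x⁆∪p∣ {x = zero}  {inside  ∷ p} x∉p = contradiction here x∉p
∣⁅x⁆∪p∣ {x = suc x} {outside ∷ p} x∉p = ∣⁅x⁆∪p∣ (x∉p ∘ there)
∣⁅x⁆∪p∣ {x = suc x} {inside  ∷ p} x∉p = cong suc (∣⁅x⁆∪p∣ (x∉p ∘ there))

injectiveOn-∷ : {κ : Fin (suc m) → Fin n} {b : Bool} {s : Subset m} →
  InjectiveOn κ (b ∷ s) → InjectiveOn (κ ∘ suc) s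
injectiveOn-∷ κ-inj u v u∈ v∈ κu≡κv =
  Finₚ.suc-injective (κ-inj (suc u) (suc v) (there u∈) (there v∈) κu≡κv)

∣image∣ : (κ : Fin m → Fin n) (s : Subset m) → InjectiveOn κ s → ∣ image κ s ∣ ≡ ∣ s ∣
∣image∣ {n = n} κ []            _     = ∣⊥∣≡0 n
∣image∣         κ (outside ∷ s) κ-inj = ∣image∣ (κ ∘ suc) s (injectiveOn-∷ κ-inj)
∣image∣         κ (inside  ∷ s) κ-inj =
  trans (∣⁅x⁆∪p∣ κ0∉) (cong suc (∣image∣ (κ ∘ suc) s (injectiveOn-∷ κ-inj)))
  where
  κ0∉ : κ zero ∉ image (κ ∘ suc) s
  κ0∉ κ0∈ with ∈-image⁻ (κ ∘ suc) s κ0∈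
  ... | v , v∈s , κv≡κ0 with κ-inj (suc v) zero (there v∈s) here κv≡κ0
  ... | ()

fSC-vanish : (Γ : SimplicialComplex n) {D : ℕ} → (∀ σ → T (face Γ σ) → ∣ σ ∣ ≤ D) →
  ∀ i → D < i → fSC Γ i ≡ 0
fSC-vanish Γ {D} size≤D i D<i = count-false no-face-of-size-i (allSubsets _)
  where
  no-face-of-size-i : ∀ σ → face Γ σ ∧ (∣ σ ∣ ≡ᵇ i) ≡ false
  no-face-of-size-i σ with face Γ σ in σ∈Γ
  ... | false = refl
  ... | true  =
    ≢⇒≡ᵇ≡false (λ ∣σ∣≡i → <⇒≱ D<i (subst (_≤ D) ∣σ∣≡i (size≤D σ (Equivalence.from T-≡ σ∈Γ))))

0<fSC : (Γ : SimplicialComplex n) {σ : Subset n} → T (face Γ σ) → 0 < fSC Γ ∣ σ ∣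
0<fSC Γ {σ} σ∈Γ = 0<count-allSubsets _ σ (Equivalence.from T-∧ (σ∈Γ , ≡⇒≡ᵇ ∣ σ ∣ ∣ σ ∣ refl))

module Thickening {n L r : ℕ} (Γ : SimplicialComplex n) (κ : Fin n → Fin L)
                  (κ-proper : ∀ s → T (face Γ s) → InjectiveOn κ s) where

  D : ℕ
  D = L + (L + r)

  -- Both copies of every colour used by s; the last r new vertices are never blocked.
  blocked : Subset n → Subset D
  blocked s = image κ s ⧺ (image κ s ⧺ ∅)

  isFace : Subset n → Subset D → Bool
  isFace s t = face Γ s ∧ does (t ⊆? ∁ (blocked s))

  face′ : Subset (n + D) → Bool
  face′ σ = isFace (take n σ) (drop n σ)

  face′-++ : ∀ s t → face′ (s ⧺ t) ≡ isFace s t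
  face′-++ s t = cong₂ isFace (take-++ s t) (drop-++ s t)

  face′-++⁻ : ∀ s t → T (face′ (s ⧺ t)) → T (face Γ s) × t ⊆ ∁ (blocked s)
  face′-++⁻ s t σ∈Γ′ with Equivalence.to T-∧ (subst T (face′-++ s t) σ∈Γ′)
  ... | s∈Γ , t⊆ = s∈Γ , ⊆?-sound t⊆

  face′-++⁺ : ∀ s t → T (face Γ s) → t ⊆ ∁ (blocked s) → T (face′ (s ⧺ t))
  face′-++⁺ s t s∈Γ t⊆ = subst T (sym (face′-++ s t)) (Equivalence.from T-∧ (s∈Γ , ⊆?-complete t⊆))

  blocked-mono : ∀ {s s′} → s ⊆ s′ → blocked s ⊆ blocked s′
  blocked-mono s⊆s′ = ⊆-++⁺ (image-mono κ s⊆s′) (⊆-++⁺ (image-mono κ s⊆s′) ⊆-refl)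

  ∣blocked∣ : ∀ s → T (face Γ s) → ∣ blocked s ∣ ≡ 2 * ∣ s ∣
  ∣blocked∣ s s∈Γ = trans (∣++∣ (image κ s) _)
    (cong₂ _+_ ∣κs∣ (trans (∣++∣ (image κ s) ∅) (cong₂ _+_ ∣κs∣ (∣⊥∣≡0 r))))
    where
    ∣κs∣ : ∣ image κ s ∣ ≡ ∣ s ∣
    ∣κs∣ = ∣image∣ κ s (κ-proper s s∈Γ)

  ∣∁blocked∣ : ∀ s → T (face Γ s) → ∣ ∁ (blocked s) ∣ ≡ D ∸ 2 * ∣ s ∣
  ∣∁blocked∣ s s∈Γ = trans (∣∁p∣≡n∸∣p∣ (blocked s)) (cong (D ∸_) (∣blocked∣ s s∈Γ))

  downClosed′ : ∀ σ τ → τ ⊆ σ → T (face′ σ) → T (face′ τ)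
  downClosed′ = ++-elim n {P = λ σ → ∀ τ → τ ⊆ σ → T (face′ σ) → T (face′ τ)} λ s t →
    ++-elim n {P = λ τ → τ ⊆ s ⧺ t → T (face′ (s ⧺ t)) → T (face′ τ)} λ s′ t′ τ⊆σ σ∈Γ′ →
      let s′⊆s , t′⊆t = ⊆-++⁻ τ⊆σ
          s∈Γ , t⊆     = face′-++⁻ s t σ∈Γ′
      in face′-++⁺ s′ t′ (downClosed Γ s s′ s′⊆s s∈Γ)
                   (⊆-trans t′⊆t (⊆-trans t⊆ (p⊆q⇒∁p⊇∁q (blocked-mono s′⊆s))))

  top : Subset (n + D)
  top = ∅ {n} ⧺ ∁ (blocked ∅)

  top∈Γ′ : T (face′ top)
  top∈Γ′ = face′-++⁺ (∅ {n}) (∁ (blocked ∅)) (emptyFace Γ) ⊆-refl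

  Γ′ : SimplicialComplex (n + D)
  Γ′ = record { face = face′ ; emptyFace = downClosed′ top ∅ ⊥⊆ top∈Γ′ ; downClosed = downClosed′ }

  ∣top∣ : ∣ top ∣ ≡ D
  ∣top∣ = begin
    ∣ ∅ {n} ⧺ ∁ (blocked ∅) ∣       ≡⟨ ∣++∣ (∅ {n}) (∁ (blocked ∅)) ⟩
    ∣ ∅ {n} ∣ + ∣ ∁ (blocked ∅) ∣   ≡⟨ cong₂ _+_ (∣⊥∣≡0 n) (∣∁blocked∣ ∅ (emptyFace Γ)) ⟩
    D ∸ 2 * ∣ ∅ {n} ∣               ≡⟨ cong (λ k → D ∸ 2 * k) (∣⊥∣≡0 n) ⟩
    D                               ∎
    where open ≡-Reasoning

  face′-size : ∀ σ → T (face′ σ) → ∣ σ ∣ ≤ D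
  face′-size = ++-elim n {P = λ σ → T (face′ σ) → ∣ σ ∣ ≤ D} λ s t σ∈Γ′ →
    let s∈Γ , t⊆ = face′-++⁻ s t σ∈Γ′
        2∣s∣≤D  = subst (_≤ D) (∣blocked∣ s s∈Γ) (∣p∣≤n (blocked s))
    in begin
      ∣ s ⧺ t ∣                   ≡⟨ ∣++∣ s t ⟩
      ∣ s ∣ + ∣ t ∣               ≤⟨ +-monoʳ-≤ ∣ s ∣ (subst (∣ t ∣ ≤_) (∣∁blocked∣ s s∈Γ) (p⊆q⇒∣p∣≤∣q∣ t⊆)) ⟩
      ∣ s ∣ + (D ∸ 2 * ∣ s ∣)     ≤⟨ +-monoˡ-≤ (D ∸ 2 * ∣ s ∣) (m≤m+n ∣ s ∣ _) ⟩
      2 * ∣ s ∣ + (D ∸ 2 * ∣ s ∣) ≡⟨ m+[n∸m]≡n 2∣s∣≤D ⟩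
      D                           ∎
    where open ≤-Reasoning

  count-faces-over : ∀ i s →
    count (λ t → face′ (s ⧺ t) ∧ (∣ s ⧺ t ∣ ≡ᵇ i)) (allSubsets D) ≡
    (if face Γ s then coeffShift (D ∸ 2 * ∣ s ∣) ∣ s ∣ i else 0)
  count-faces-over i s = trans (count-cong split (allSubsets D)) (by-membership (face Γ s) refl)
    where
    split : ∀ t → face′ (s ⧺ t) ∧ (∣ s ⧺ t ∣ ≡ᵇ i) ≡
                  face Γ s ∧ (does (t ⊆? ∁ (blocked s)) ∧ (∣ s ∣ + ∣ t ∣ ≡ᵇ i))
    split t rewrite face′-++ s t | ∣++∣ s t = ∧-assoc (face Γ s) _ _
    by-membership : ∀ b → face Γ s ≡ b →
      count (λ t → b ∧ (does (t ⊆? ∁ (blocked s)) ∧ (∣ s ∣ + ∣ t ∣ ≡ᵇ i))) (allSubsets D) ≡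
      (if b then coeffShift (D ∸ 2 * ∣ s ∣) ∣ s ∣ i else 0)
    by-membership true  s∈Γ = trans (count-subsets-of-shifted-size (∁ (blocked s)) ∣ s ∣ i)
      (cong (λ k → coeffShift k ∣ s ∣ i) (∣∁blocked∣ s (Equivalence.from T-≡ s∈Γ)))
    by-membership false _   = count-false (λ _ → refl) (allSubsets D)

  fSC-Γ′ : (∀ s → T (face Γ s) → ∣ s ∣ ≤ L) →
    ∀ i → fSC Γ′ i ≡ sumUpTo L (λ j → fSC Γ j * coeffShift (D ∸ 2 * j) j i)
  fSC-Γ′ size≤L i = begin
    fSC Γ′ i
      ≡⟨ count-allSubsets-++ n _ ⟩
    sum (map (λ s → count (λ t → face′ (s ⧺ t) ∧ (∣ s ⧺ t ∣ ≡ᵇ i)) (allSubsets D)) (allSubsets n))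
      ≡⟨ cong sum (map-cong (count-faces-over i) (allSubsets n)) ⟩
    sum (map (λ s → if face Γ s then coeffShift (D ∸ 2 * ∣ s ∣) ∣ s ∣ i else 0) (allSubsets n))
      ≡⟨ sum-by-size ∣_∣ (face Γ) (λ j → coeffShift (D ∸ 2 * j) j i) L (allSubsets n) size≤L ⟩
    sumUpTo L (λ j → fSC Γ j * coeffShift (D ∸ 2 * j) j i) ∎
    where open ≡-Reasoning

  colourˢ : Fin n ⊎ Fin D → Fin D
  colourˢ = [ (λ v → κ v ↑ˡ (L + r)) , id ]′

  colour : Fin (n + D) → Fin D
  colour u = colourˢ (splitAt n u)

  old-colour≢new : ∀ s {t a p} → t ⊆ ∁ (blocked s) → a ∈ s → p ∈ t → κ a ↑ˡ (L + r) ≢ p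
  old-colour≢new s t⊆ a∈s p∈t refl = x∈p⇒x∉∁p (∈-++⁺ˡ (∈-image⁺ κ a∈s)) (t⊆ p∈t)

  colourˢ-proper : ∀ s t → T (face Γ s) → t ⊆ ∁ (blocked s) → ∀ x y →
    join n D x ∈ s ⧺ t → join n D y ∈ s ⧺ t → colourˢ x ≡ colourˢ y → x ≡ y
  colourˢ-proper s t s∈Γ t⊆ (inj₁ a) (inj₁ b) a∈ b∈ e = cong inj₁
    (κ-proper s s∈Γ a b (∈-++⁻ˡ a a∈) (∈-++⁻ˡ b b∈) (↑ˡ-injective (L + r) (κ a) (κ b) e))
  colourˢ-proper s t s∈Γ t⊆ (inj₁ a) (inj₂ p) a∈ p∈ e =
    ⊥-elim (old-colour≢new s t⊆ (∈-++⁻ˡ a a∈) (∈-++⁻ʳ s p∈) e)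
  colourˢ-proper s t s∈Γ t⊆ (inj₂ p) (inj₁ a) p∈ a∈ e =
    ⊥-elim (old-colour≢new s t⊆ (∈-++⁻ˡ a a∈) (∈-++⁻ʳ s p∈) (sym e))
  colourˢ-proper s t s∈Γ t⊆ (inj₂ p) (inj₂ q) p∈ q∈ e = cong inj₂ e

  colour-proper : ∀ σ → T (face′ σ) → InjectiveOn colour σ
  colour-proper = ++-elim n {P = λ σ → T (face′ σ) → InjectiveOn colour σ} λ s t σ∈Γ′ u v u∈ v∈ e →
    let s∈Γ , t⊆ = face′-++⁻ s t σ∈Γ′
        split∈ : ∀ {w} → w ∈ s ⧺ t → join n D (splitAt n w) ∈ s ⧺ t
        split∈ {w} = subst (_∈ s ⧺ t) (sym (join-splitAt n D w))
        splits≡ = colourˢ-proper s t s∈Γ t⊆ (splitAt n u) (splitAt n v) (split∈ u∈) (split∈ v∈) e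
    in begin
      u                          ≡⟨ join-splitAt n D u ⟨
      join n D (splitAt n u)     ≡⟨ cong (join n D) splits≡ ⟩
      join n D (splitAt n v)     ≡⟨ join-splitAt n D v ⟩
      v                          ∎
    where open ≡-Reasoning

  Γ′-balanced : IsBalanced Γ′
  Γ′-balanced = D , (face′-size , top , top∈Γ′ , ∣top∣) , colour , colour-proper

⌊n/2⌋+⌊n/2⌋≤n : ∀ d → ⌊ d /2⌋ + ⌊ d /2⌋ ≤ d
⌊n/2⌋+⌊n/2⌋≤n d = ≤-trans (+-monoʳ-≤ ⌊ d /2⌋ (⌊n/2⌋≤⌈n/2⌉ d)) (≤-reflexive (⌊n/2⌋+⌈n/2⌉≡n d))

balanced-γ⇒balanced-h : ∀ d (h γ : ℕ → ℤ) → IsGammaVector d h γ →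
  IsBalancedFVector ⌊ d /2⌋ γ → IsBalancedFVector d h
balanced-γ⇒balanced-h d h γ h≡γ (n , Γ , (m , (size≤m , σ , σ∈Γ , ∣σ∣≡m) , κ , κ-proper) , fΓ≡γ , fΓ-vanish) =
  n + D , Γ′ , Γ′-balanced , fΓ′≡h , fSC-vanish Γ′ (λ τ τ∈Γ′ → subst (∣ τ ∣ ≤_) D≡d (face′-size τ τ∈Γ′))
  where
  L = ⌊ d /2⌋

  m≤L : m ≤ L
  m≤L = ≮⇒≥ λ L<m → n≮0 (subst (0 <_) (fΓ-vanish m L<m) (subst (λ k → 0 < fSC Γ k) ∣σ∣≡m (0<fSC Γ σ∈Γ)))

  open Thickening {r = d ∸ (L + L)} Γ (λ v → inject≤ (κ v) m≤L)
    (λ s s∈Γ u v u∈ v∈ e → κ-proper s s∈Γ u v u∈ v∈ (inject≤-injective m≤L m≤L (κ u) (κ v) e))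

  D≡d : D ≡ d
  D≡d = trans (sym (+-assoc L L _)) (m+[n∸m]≡n (⌊n/2⌋+⌊n/2⌋≤n d))

  fΓ′≡h : ∀ i → i ≤ d → + fSC Γ′ i ≡ h i
  fΓ′≡h i i≤d = begin
    + fSC Γ′ i
      ≡⟨ cong +_ (fSC-Γ′ (λ s s∈Γ → ≤-trans (size≤m s s∈Γ) m≤L) i) ⟩
    + sumUpTo L (λ j → fSC Γ j * coeffShift (D ∸ 2 * j) j i)
      ≡⟨ +-sumUpTo L _ ⟩
    sumTo L (λ j → + (fSC Γ j * coeffShift (D ∸ 2 * j) j i))
      ≡⟨ sumTo-cong L (λ j j≤L → trans (pos-* (fSC Γ j) _)
           (cong₂ ℤ._*_ (fΓ≡γ j j≤L) (cong (λ k → + coeffShift (k ∸ 2 * j) j i) D≡d))) ⟩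
    sumTo L (λ j → γ j ℤ.* + coeffShift (d ∸ 2 * j) j i)
      ≡⟨ h≡γ i i≤d ⟨
    h i ∎
    where open ≡-Reasoning

proposition6p8 : (Δ : BooleanComplex) (d : ℕ) → HasDim-1 Δ d →
    (∀ k → k ≤ d → + 0 ≤ℤ hBC Δ d k) →
    (∀ k → k ≤ d → hBC Δ d k ≡ hBC Δ d (d ∸ k)) →
    (γ : ℕ → ℤ) → IsGammaVector d (hBC Δ d) γ →
    IsBalancedFVector ⌊ d /2⌋ γ →
    IsBalancedFVector d (hBC Δ d)
proposition6p8 Δ d _ _ _ γ h≡γ = balanced-γ⇒balanced-h d (hBC Δ d) γ h≡γ
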